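{- Let $\mathcal{I}=(V,\{A_x\},\{R_{xy}\},w)$ be an instance of $\mathrm{CSP}(\mathcal{A})$ with $|V|>1$, such that every domain $\mathbb{A}_x$ is either trivial ($|A_x|=1$) or is subdirectly irreducible and prime. Then for each variable $x\in V$: - there is at least one variable $y\neq x$ with $\theta_{xy}=0_{A_x}$; - for every such $y$, the relation $R_{yx}$ is the graph of a surjective homomorphism from $\mathbb{A}_y$ to $\mathbb{A}_x$.
   Context: Let $\mathbf{A}$ be a finite relational structure with a majority polymorphism and a Maltsev polymorphism, and let $\mathcal{A}$ be the variety generated by $\mathrm{Alg}(\mathbf{A})=(A;\mathrm{Pol}(\mathbf{A}))$. An instance of $\mathrm{CSP}(\mathcal{A})$ is $(V,\{A_x\},\{R_{xy}\},w)$ with the following properties: - each $A_x$ is the universe of $\mathbb{A}_x\in\mathcal{A}$; - for each pair $(x,y)$ there is exactly one binary constraint relation $R_{xy}$, a subuniverse of $\mathbb{A}_x\times\mathbb{A}_y$; - $R_{xx}=0_{A_x}$ (equality) and $R_{yx}=R_{xy}^{ -1}$; - the instance is 2-consistent, so each $R_{xy}$ with $x\neq y$ is subdirect in $A_x\times A_y$. For $x\neq y$, $\theta_{xy}=\{(a,a')\in A_x^2:\exists b\in A_y,\ (a,b),(a',b)\in R_{xy}\}$ is a congruence of $\mathbb{A}_x$. Let $\mu_x=\bigwedge_{y\neq x}\theta_{xy}$; the domain $A_x$ is prime if $\mu_x=0_{A_x}$. An algebra is subdirectly irreducible if it has a smallest non-trivial congruence. -}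

module Defs where

open import Data.Nat using (ℕ; _≤_)
open import Data.Fin using (Fin)
open import Data.Product using (Σ; Σ-syntax; ∃; ∃-syntax; _×_; _,_)
open import Data.Sum using (_⊎_)
open import Relation.Binary.PropositionalEquality using (_≡_; _≢_)
open import Relation.Nullary using (Dec)

record RelStr : Set₁ where
  field
    size  : ℕ
    nRel  : ℕ
    arity : Fin nRel → ℕ
    rel   : (i : Fin nRel) → (Fin (arity i) → Fin size) → Set

module _ (𝔸 : RelStr) where
  open RelStr 𝔸

  IsPol : (k : ℕ) → ((Fin k → Fin size) → Fin size) → Set
  IsPol k f = ∀ (i : Fin nRel) (rows : Fin k → Fin (arity i) → Fin size) →
              (∀ j → rel i (rows j)) → rel i (λ l → f (λ j → rows j l))

  ap3 : ((Fin 3 → Fin size) → Fin size) → Fin size → Fin size → Fin size → Fin size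
  ap3 f a b c = f λ { Fin.zero → a ; (Fin.suc Fin.zero) → b ; (Fin.suc (Fin.suc Fin.zero)) → c }

  HasMajorityPol : Set
  HasMajorityPol = Σ[ m ∈ ((Fin 3 → Fin size) → Fin size) ] IsPol 3 m ×
    (∀ a b → ap3 m a a b ≡ a × ap3 m a b a ≡ a × ap3 m b a a ≡ a)

  HasMaltsevPol : Set
  HasMaltsevPol = Σ[ p ∈ ((Fin 3 → Fin size) → Fin size) ] IsPol 3 p ×
    (∀ a b → ap3 p a b b ≡ a × ap3 p b b a ≡ a)

  -- Signature of Alg(𝔸) = (A; Pol(𝔸)): one operation symbol for each
  -- polymorphism, of its arity.
  PolSym : Set
  PolSym = Σ[ k ∈ ℕ ] Σ[ f ∈ ((Fin k → Fin size) → Fin size) ] IsPol k f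

  symArity : PolSym → ℕ
  symArity (k , _ , _) = k

  record FinAlg : Set where
    field
      card : ℕ
      op   : (s : PolSym) → (Fin (symArity s) → Fin card) → Fin card

  Alg : FinAlg
  Alg = record { card = size ; op = λ { (k , f , _) → f } }

  data Term : Set where
    var : ℕ → Term
    app : (s : PolSym) → (Fin (symArity s) → Term) → Term

  eval : (B : FinAlg) → (ℕ → Fin (FinAlg.card B)) → Term → Fin (FinAlg.card B)
  eval B ρ (var v)   = ρ v
  eval B ρ (app s t) = FinAlg.op B s (λ j → eval B ρ (t j))

  _⊨_≈_ : FinAlg → Term → Term → Set
  B ⊨ s ≈ t = ∀ (ρ : ℕ → Fin (FinAlg.card B)) → eval B ρ s ≡ eval B ρ t

  -- B lies in the variety 𝒜 generated by Alg(𝔸): B satisfies every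
  -- identity satisfied by Alg(𝔸).
  InVariety : FinAlg → Set
  InVariety B = ∀ s t → Alg ⊨ s ≈ t → B ⊨ s ≈ t

  BinRel : ℕ → Set₁
  BinRel n = Fin n → Fin n → Set

  IsZero : {n : ℕ} → BinRel n → Set
  IsZero r = ∀ a b → (r a b → a ≡ b) × (a ≡ b → r a b)

  IsCongruence : (B : FinAlg) → BinRel (FinAlg.card B) → Set
  IsCongruence B r =
    (∀ a → r a a) × (∀ a b → r a b → r b a) × (∀ a b c → r a b → r b c → r a c) ×
    (∀ (s : PolSym) (u v : Fin (symArity s) → Fin (FinAlg.card B)) →
       (∀ j → r (u j) (v j)) → r (FinAlg.op B s u) (FinAlg.op B s v))

  NonTrivial : {n : ℕ} → BinRel n → Set
  NonTrivial r = ∃[ a ] ∃[ b ] (a ≢ b × r a b)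

  SubdirectlyIrreducible : FinAlg → Set₁
  SubdirectlyIrreducible B =
    Σ[ β ∈ BinRel (FinAlg.card B) ] IsCongruence B β × NonTrivial β ×
      (∀ γ → IsCongruence B γ → NonTrivial γ → ∀ a b → β a b → γ a b)

  IsHom : (B C : FinAlg) → (Fin (FinAlg.card B) → Fin (FinAlg.card C)) → Set
  IsHom B C h = ∀ (s : PolSym) (u : Fin (symArity s) → Fin (FinAlg.card B)) →
    h (FinAlg.op B s u) ≡ FinAlg.op C s (λ j → h (u j))

  record Instance : Set₁ where
    field
      nVar   : ℕ
      dom    : Fin nVar → FinAlg
      inVar  : ∀ x → InVariety (dom x)
      R      : (x y : Fin nVar) → Fin (FinAlg.card (dom x)) → Fin (FinAlg.card (dom y)) → Set
      R-dec  : ∀ x y a b → Dec (R x y a b)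
      R-sub  : ∀ x y (s : PolSym) (u : Fin (symArity s) → Fin (FinAlg.card (dom x)))
                 (v : Fin (symArity s) → Fin (FinAlg.card (dom y))) →
                 (∀ j → R x y (u j) (v j)) →
                 R x y (FinAlg.op (dom x) s u) (FinAlg.op (dom y) s v)
      R-diag : ∀ x → IsZero (R x x)
      R-inv  : ∀ x y a b → (R y x b a → R x y a b) × (R x y a b → R y x b a)
      -- 2-consistency: R_xy subdirect for x ≠ y
      R-left  : ∀ x y → x ≢ y → ∀ a → ∃[ b ] R x y a b
      R-right : ∀ x y → x ≢ y → ∀ b → ∃[ a ] R x y a b

  module _ (I : Instance) where
    open Instance I

    Dom : Fin nVar → Set
    Dom x = Fin (FinAlg.card (dom x))

    θ : (x y : Fin nVar) → BinRel (FinAlg.card (dom x))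
    θ x y a a' = ∃[ b ] (R x y a b × R x y a' b)

    μ : (x : Fin nVar) → BinRel (FinAlg.card (dom x))
    μ x a a' = ∀ y → y ≢ x → θ x y a a'

    Prime : Fin nVar → Set
    Prime x = IsZero (μ x)

    GraphOfSurjHom : (y x : Fin nVar) → Set
    GraphOfSurjHom y x =
      Σ[ h ∈ (Dom y → Dom x) ] IsHom (dom y) (dom x) h ×
        (∀ c → ∃[ b ] h b ≡ c) ×
        (∀ b a → (R y x b a → h b ≡ a) × (h b ≡ a → R y x b a))

module Submission where

-- Proof idea.  Write Linked S for the relation a ~ a' ⇔ ∃c. S a c ∧ S a' c
-- induced on B by a relation S ⊆ B × C, so that θ_xy = Linked R_xy.
--
-- (1) Every algebra of 𝒜 satisfies the Maltsev identities, so every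
--     subuniverse S of B × C (B, C ∈ 𝒜) is rectangular, and if S is
--     left-total then Linked S is a congruence of B.
-- (2) If Linked S is equality and S is subdirect, S is the graph of a
--     surjective homomorphism C → B.  This is the second claim.
-- (3) For the first claim suppose every θ_xy (y ≠ x) is non-trivial.
--     A one-element domain has no non-trivial relation at all; in a
--     subdirectly irreducible domain the monolith lies below every
--     non-trivial congruence, hence below μ_x = ⋂ θ_xy, so μ_x is
--     non-trivial, contradicting primality.  Since θ_xy is decidable,
--     some y ≠ x therefore has θ_xy = 0.

open import Defs
open import Data.Nat using (ℕ; _≤_; s≤s; z≤n)
open import Data.Fin using (Fin; zero; suc)
open import Data.Fin.Properties using (any?; _≟_)
open import Data.Product using (Σ-syntax; ∃-syntax; _×_; _,_; proj₁; proj₂)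
open import Data.Sum using (_⊎_; inj₁; inj₂)
open import Data.Empty using (⊥-elim)
open import Relation.Nullary using (Dec; yes; no; ¬_)
open import Relation.Nullary.Decidable using (_×-dec_; ¬?; decidable-stable)
open import Relation.Binary.PropositionalEquality using (_≡_; _≢_; refl; ≢-sym; subst₂)

another : ∀ {n} → 2 ≤ n → (x : Fin n) → ∃[ y ] y ≢ x
another (s≤s (s≤s z≤n)) zero    = suc zero , λ ()
another (s≤s (s≤s z≤n)) (suc _) = zero , λ ()

module _ (𝔸 : RelStr) where

  zero-not-nontrivial : ∀ {n} {r : BinRel 𝔸 n} → IsZero 𝔸 r → ¬ NonTrivial 𝔸 r
  zero-not-nontrivial r=0 (a , b , a≢b , rab) = a≢b (proj₁ (r=0 a b) rab)

  singleton-trivial : ∀ {n} → n ≡ 1 → (r : BinRel 𝔸 n) → ¬ NonTrivial 𝔸 r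
  singleton-trivial refl r (zero , zero , 0≢0 , _) = 0≢0 refl

  nontrivial? : ∀ {n} (r : BinRel 𝔸 n) → (∀ a b → Dec (r a b)) → Dec (NonTrivial 𝔸 r)
  nontrivial? r r? = any? λ a → any? λ b → ¬? (a ≟ b) ×-dec r? a b

  zero-of-trivial : ∀ {n} (r : BinRel 𝔸 n) → (∀ a → r a a) → ¬ NonTrivial 𝔸 r → IsZero 𝔸 r
  zero-of-trivial r refl-r ¬nt a b = only-diagonal , λ { refl → refl-r a }
    where
    only-diagonal : r a b → a ≡ b
    only-diagonal rab with a ≟ b
    ... | yes a≡b = a≡b
    ... | no  a≢b = ⊥-elim (¬nt (a , b , a≢b , rab))

  -- In a subdirectly irreducible algebra the monolith lies below every
  -- non-trivial congruence, so any intersection of non-trivial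
  -- congruences is again non-trivial.
  SI-meet-nontrivial : (B : FinAlg 𝔸) → SubdirectlyIrreducible 𝔸 B →
    {J : Set} (P : J → Set) (γ : J → BinRel 𝔸 (FinAlg.card B)) →
    (∀ j → P j → IsCongruence 𝔸 B (γ j)) → (∀ j → P j → NonTrivial 𝔸 (γ j)) →
    NonTrivial 𝔸 (λ a b → ∀ j → P j → γ j a b)
  SI-meet-nontrivial B (β , _ , (a , b , a≢b , βab) , least) P γ γ-cong γ-nt =
    a , b , a≢b , λ j Pj → least (γ j) (γ-cong j Pj) (γ-nt j Pj) a b βab

  module _ (B C : FinAlg 𝔸) where
    open FinAlg B using () renaming (card to |B|; op to opB)
    open FinAlg C using () renaming (card to |C|; op to opC)

    IsSubuniverse : (Fin |B| → Fin |C| → Set) → Set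
    IsSubuniverse S = ∀ (s : PolSym 𝔸) u v → (∀ j → S (u j) (v j)) → S (opB s u) (opC s v)

    Linked : (Fin |B| → Fin |C| → Set) → BinRel 𝔸 |B|
    Linked S a a' = ∃[ c ] (S a c × S a' c)

    graph-of-hom : (S : Fin |B| → Fin |C| → Set) → IsSubuniverse S →
      (∀ a → ∃[ c ] S a c) → (∀ c → ∃[ a ] S a c) →
      (∀ a a' → Linked S a a' → a ≡ a') →
      Σ[ h ∈ (Fin |C| → Fin |B|) ] IsHom 𝔸 C B h × (∀ a → ∃[ c ] h c ≡ a) ×
        (∀ a c → (S a c → h c ≡ a) × (h c ≡ a → S a c))
    graph-of-hom S S-sub left-total right-total unlinked = h , h-hom , h-onto , h-graph
      where
      functional : ∀ {a a' c} → S a c → S a' c → a ≡ a'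
      functional Sac Sa'c = unlinked _ _ (_ , Sac , Sa'c)
      h : Fin |C| → Fin |B|
      h c = proj₁ (right-total c)
      S-h : ∀ c → S (h c) c
      S-h c = proj₂ (right-total c)
      h-hom : IsHom 𝔸 C B h
      h-hom s u = functional (S-h (opC s u)) (S-sub s (λ j → h (u j)) u (λ j → S-h (u j)))
      h-onto : ∀ a → ∃[ c ] h c ≡ a
      h-onto a = let (c , Sac) = left-total a in c , functional (S-h c) Sac
      h-graph : ∀ a c → (S a c → h c ≡ a) × (h c ≡ a → S a c)
      h-graph a c = functional (S-h c) , λ { refl → S-h c }

  module _ (maltsev : HasMaltsevPol 𝔸) where
    open RelStr 𝔸 using (size; arity; rel)

    -- The triple (a, b, c) exactly as Defs.ap3 hands it to an operation.
    triple : Fin size → Fin size → Fin size → Fin 3 → Fin size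
    triple a b c j = ap3 𝔸 (λ g → g j) a b c

    -- The Maltsev polymorphism p, made to read its arguments pointwise:
    -- it agrees with p, but p(g) computes whenever g j does for each
    -- constructor j, which is what evaluating a term requires.
    maltsevOp : (Fin 3 → Fin size) → Fin size
    maltsevOp g = proj₁ maltsev (triple (g zero) (g (suc zero)) (g (suc (suc zero))))

    maltsevOp-pol : IsPol 𝔸 3 maltsevOp
    maltsevOp-pol i rows rows∈ = proj₁ (proj₂ maltsev) i spread spread∈
      where
      spread : Fin 3 → Fin (arity i) → Fin size
      spread j l = triple (rows zero l) (rows (suc zero) l) (rows (suc (suc zero)) l) j
      spread∈ : ∀ j → rel i (spread j)
      spread∈ zero             = rows∈ zero
      spread∈ (suc zero)       = rows∈ (suc zero)
      spread∈ (suc (suc zero)) = rows∈ (suc (suc zero))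

    maltsevSym : PolSym 𝔸
    maltsevSym = 3 , maltsevOp , maltsevOp-pol

    xyy xxy : Fin 3 → ℕ
    xyy zero = 0
    xyy (suc _) = 1
    xxy (suc (suc zero)) = 1
    xxy _ = 0

    env : {X : Set} → X → X → ℕ → X
    env a b 0 = a
    env a b _ = b

    maltsev-xyy : (B : FinAlg 𝔸) → InVariety 𝔸 B → ∀ a b →
      FinAlg.op B maltsevSym (λ j → env a b (xyy j)) ≡ a
    maltsev-xyy B B∈𝒜 a b = B∈𝒜 (app maltsevSym (λ j → var (xyy j))) (var 0)
      (λ ρ → proj₁ (proj₂ (proj₂ maltsev) (ρ 0) (ρ 1))) (env a b)

    maltsev-xxy : (B : FinAlg 𝔸) → InVariety 𝔸 B → ∀ a b →
      FinAlg.op B maltsevSym (λ j → env a b (xxy j)) ≡ b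
    maltsev-xxy B B∈𝒜 a b = B∈𝒜 (app maltsevSym (λ j → var (xxy j))) (var 1)
      (λ ρ → proj₂ (proj₂ (proj₂ maltsev) (ρ 1) (ρ 0))) (env a b)

    module _ (B C : FinAlg 𝔸) (B∈𝒜 : InVariety 𝔸 B) (C∈𝒜 : InVariety 𝔸 C)
             (S : Fin (FinAlg.card B) → Fin (FinAlg.card C) → Set)
             (S-sub : IsSubuniverse B C S) where

      -- Subuniverses of products in a Maltsev variety are rectangular:
      -- apply p to the pairs (a, b), (a', b), (a', b').
      rectangular : ∀ {a a' b b'} → S a b → S a' b → S a' b' → S a b'
      rectangular {a} {a'} {b} {b'} Sab Sa'b Sa'b' =
        subst₂ S (maltsev-xyy B B∈𝒜 a a') (maltsev-xxy C C∈𝒜 b b')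
          (S-sub maltsevSym (λ j → env a a' (xyy j)) (λ j → env b b' (xxy j)) columns)
        where
        columns : ∀ j → S (env a a' (xyy j)) (env b b' (xxy j))
        columns zero             = Sab
        columns (suc zero)       = Sa'b
        columns (suc (suc zero)) = Sa'b'

      -- For a left-total subuniverse, linkedness is a congruence of B;
      -- transitivity is rectangularity.
      linked-congruence : (∀ a → ∃[ c ] S a c) → IsCongruence 𝔸 B (Linked B C S)
      linked-congruence left-total = reflexive , symmetric , transitive , compatible
        where
        reflexive : ∀ a → Linked B C S a a
        reflexive a = let (c , Sac) = left-total a in c , Sac , Sac
        symmetric : ∀ a a' → Linked B C S a a' → Linked B C S a' a
        symmetric _ _ (c , Sac , Sa'c) = c , Sa'c , Sac
        transitive : ∀ a a' a'' → Linked B C S a a' → Linked B C S a' a'' → Linked B C S a a''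
        transitive _ _ _ (c , Sac , Sa'c) (c' , Sa'c' , Sa''c') =
          c' , rectangular Sac Sa'c Sa'c' , Sa''c'
        compatible : ∀ (s : PolSym 𝔸) u v → (∀ j → Linked B C S (u j) (v j)) →
          Linked B C S (FinAlg.op B s u) (FinAlg.op B s v)
        compatible s u v uv = FinAlg.op C s (λ j → proj₁ (uv j)) ,
          S-sub s u _ (λ j → proj₁ (proj₂ (uv j))) ,
          S-sub s v _ (λ j → proj₂ (proj₂ (uv j)))

  module _ (I : Instance 𝔸) where
    open Instance I

    θ-congruence : HasMaltsevPol 𝔸 → ∀ x y → x ≢ y → IsCongruence 𝔸 (dom x) (θ 𝔸 I x y)
    θ-congruence maltsev x y x≢y =
      linked-congruence maltsev (dom x) (dom y) (inVar x) (inVar y) (R x y) (R-sub x y)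
        (R-left x y x≢y)

    θ-nontrivial? : ∀ x y → Dec (NonTrivial 𝔸 (θ 𝔸 I x y))
    θ-nontrivial? x y = nontrivial? (θ 𝔸 I x y)
      λ a a' → any? λ c → R-dec x y a c ×-dec R-dec x y a' c

    θ-zero-or-nontrivial : HasMaltsevPol 𝔸 → ∀ x →
      (Σ[ y ∈ Fin nVar ] (y ≢ x × IsZero 𝔸 (θ 𝔸 I x y))) ⊎
      (∀ y → y ≢ x → NonTrivial 𝔸 (θ 𝔸 I x y))
    θ-zero-or-nontrivial maltsev x with any? (λ y → ¬? (y ≟ x) ×-dec ¬? (θ-nontrivial? x y))
    ... | yes (y , y≢x , ¬nt) = inj₁ (y , y≢x , zero-of-trivial (θ 𝔸 I x y)
            (proj₁ (θ-congruence maltsev x y (≢-sym y≢x))) ¬nt)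
    ... | no none = inj₂ λ y y≢x → decidable-stable (θ-nontrivial? x y) λ ¬nt → none (y , y≢x , ¬nt)

    θ-zero-graph : ∀ x y → y ≢ x → IsZero 𝔸 (θ 𝔸 I x y) → GraphOfSurjHom 𝔸 I y x
    θ-zero-graph x y y≢x θ=0
      with graph-of-hom (dom x) (dom y) (R x y) (R-sub x y)
             (R-left x y (≢-sym y≢x)) (R-right x y (≢-sym y≢x)) (λ a a' → proj₁ (θ=0 a a'))
    ... | h , h-hom , h-onto , h-graph = h , h-hom , h-onto , λ b a →
      (λ Ryx → proj₁ (h-graph a b) (proj₁ (R-inv x y a b) Ryx)) ,
      (λ hb≡a → proj₂ (R-inv x y a b) (proj₂ (h-graph a b) hb≡a))

lemma3p5 : (𝔸 : RelStr) → HasMajorityPol 𝔸 → HasMaltsevPol 𝔸 →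
    (I : Instance 𝔸) → 2 ≤ Instance.nVar I →
    (∀ x → FinAlg.card (Instance.dom I x) ≡ 1
           ⊎ (SubdirectlyIrreducible 𝔸 (Instance.dom I x) × Prime 𝔸 I x)) →
    ∀ x → (Σ[ y ∈ Fin (Instance.nVar I) ] (y ≢ x × IsZero 𝔸 (θ 𝔸 I x y)))
        × (∀ y → y ≢ x → IsZero 𝔸 (θ 𝔸 I x y) → GraphOfSurjHom 𝔸 I y x)
lemma3p5 𝔸 _ maltsev I two-vars domains x = some-θ-zero , θ-zero-graph 𝔸 I x
  where
  open Instance I using (nVar; dom)
  some-θ-zero : Σ[ y ∈ Fin nVar ] (y ≢ x × IsZero 𝔸 (θ 𝔸 I x y))
  some-θ-zero with θ-zero-or-nontrivial 𝔸 I maltsev x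
  ... | inj₁ found = found
  ... | inj₂ all-nontrivial with domains x
  ... | inj₁ one-element =
        let (y , y≢x) = another two-vars x
        in ⊥-elim (singleton-trivial 𝔸 one-element (θ 𝔸 I x y) (all-nontrivial y y≢x))
  ... | inj₂ (irreducible , prime) =
        ⊥-elim (zero-not-nontrivial 𝔸 prime
          (SI-meet-nontrivial 𝔸 (dom x) irreducible (_≢ x) (θ 𝔸 I x)
            (λ y y≢x → θ-congruence 𝔸 I maltsev x y (≢-sym y≢x))
            all-nontrivial))
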